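{- In the setting described in the context, let $N$ be odd and let $\rho=v\left(u'\frac{C}{Np}+A\left(\frac up(1-u'^2)-u'\right)\right)+3v_1A_1(u'-1)$. If $D$ is odd, then $\theta\equiv(N-1)\rho\pmod 8$ with $\rho$ even.
   Context: Setting: Let $N>1$ be an integer, $N=2^{\lambda(N)}N_1$ with $N_1$ odd. Let $D=c^2\Delta<0$ be a discriminant with fundamental part $\Delta$ and conductor $c$, $K=\mathbb Q(\sqrt D)$, $\mathcal O$ the order of discriminant $D$. Let $[A,B,C]$ be a primitive positive definite integral quadratic form with $B^2-4AC=D$, $\gcd(A,N)=1$ and $N\mid C$. Let $\alpha=\frac{ -B+\sqrt D}{2A}$, so $\mathcal O=\mathbb Z+\mathbb Z A\alpha$. Let $u,v\in\mathbb Z$ be such that $\pi=u+vA\alpha$ has norm $p=u^2-uvB+v^2AC$ a prime number not dividing $6cN$ that splits in $\mathcal O$, and assume $p\mid C$ and $p\mid u$. Set $u'=u-vB$. Let $v_1$, $A_1$ be the odd parts of $v$, $A$ ($v_1=1$ if $v=0$). Define the integer $\theta=(N-1)v\left(u'\frac{C}{Np}+A\left(\frac up(1-u'^2)-u'\right)\right)+3v_1A_1(N_1-1)(u'-1)+\frac{3\lambda(N)(u'^2-1)}{2}.$ -}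

module Defs where

open import Data.Nat using (ℕ; zero; suc)
import Data.Nat as ℕ
open import Data.Nat.Primality using (Prime)
open import Data.Integer using (ℤ; +_; -[1+_]; _+_; _-_; _*_; -_)
open import Data.Integer.DivMod using (_/ℕ_)
open import Data.Integer.Divisibility using (_∣_)
open import Data.Product using (_×_; ∃)
open import Data.Sum using (_⊎_)
open import Relation.Binary.PropositionalEquality using (_≡_)
open import Relation.Nullary using (¬_)

-- 2-adic valuation and odd part of a natural number (by fuel = n itself);
-- conventions: val2 0 = 0, oddPartℕ 0 = 1.
private
  val2Aux : ℕ → ℕ → ℕ
  val2Aux zero    n = 0
  val2Aux (suc f) n with n ℕ.% 2
  ... | zero  = suc (val2Aux f (n ℕ./ 2))
  ... | suc _ = 0

  oddAux : ℕ → ℕ → ℕ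
  oddAux zero    n = n
  oddAux (suc f) n with n ℕ.% 2
  ... | zero  = oddAux f (n ℕ./ 2)
  ... | suc _ = n

val2 : ℕ → ℕ
val2 zero = 0
val2 n@(suc _) = val2Aux n n

oddPartℕ : ℕ → ℕ
oddPartℕ zero = 1
oddPartℕ n@(suc _) = oddAux n n

-- odd part of an integer, keeping the sign (and 1 for 0)
oddPart : ℤ → ℤ
oddPart (+ n)      = + oddPartℕ n
oddPart -[1+ n ]   = - (+ oddPartℕ (suc n))

SquareFree : ℤ → Set
SquareFree d = ∀ (q : ℕ) → Prime q → ¬ ((+ (q ℕ.* q)) ∣ d)

IsFundamentalDisc : ℤ → Set
IsFundamentalDisc Δ =
  ((+ 4) ∣ (Δ - + 1) × SquareFree Δ)
  ⊎ ∃ (λ m → (Δ ≡ + 4 * m) × ((+ 4) ∣ (m - + 2) ⊎ (+ 4) ∣ (m - + 3)) × SquareFree m)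

-- the prime p (not dividing the conductor, odd) splits in the order of
-- discriminant D: D is a nonzero square modulo p
SplitsIn : ℤ → ℕ → Set
SplitsIn D p = ∃ (λ x → (+ p) ∣ (x * x - D)) × ¬ ((+ p) ∣ D)

-- θ from the context, with the exact quotients C/(Np) and u/p passed as
-- arguments cNp and up (they are determined by C ≡ cNp * N * p, u ≡ up * p).
θ : (N : ℕ) (A B v u cNp up : ℤ) → ℤ
θ N A B v u cNp up =
  let u' = u - v * B
      N1 = + oddPartℕ N
      l  = + val2 N
  in (+ N - + 1) * v * (u' * cNp + A * (up * (+ 1 - u' * u') - u'))
     + + 3 * oddPart v * oddPart A * (N1 - + 1) * (u' - + 1)
     + (+ 3 * l * (u' * u' - + 1)) /ℕ 2

ρ : (N : ℕ) (A B v u cNp up : ℤ) → ℤ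
ρ N A B v u cNp up =
  let u' = u - v * B
  in v * (u' * cNp + A * (up * (+ 1 - u' * u') - u'))
     + + 3 * oddPart v * oddPart A * (u' - + 1)

-- Part one is bookkeeping: for odd N we have λ(N) = 0 and N₁ = N, so θ = (N − 1)ρ
-- on the nose.  Evenness of ρ is a computation in ℤ/2: D odd forces B odd, and since
-- p is odd, p ≡ u² + uvB + v²AC (mod 2) while u/p ≡ u and C/(Np) ≡ C.  If v is even
-- this forces u odd and ρ ≡ v₁A₁(u' + 1) ≡ 0; if v is odd it forces A and C odd,
-- hence v₁ = v and A₁ = A are odd, and the remaining terms cancel.
module Submission where

open import Defs
open import Data.Nat using (ℕ; _<_; zero; suc; parity)
import Data.Nat as ℕ
import Data.Nat.Divisibility as ℕd
open import Data.Nat.Primality using (Prime; prime⇒irreducible)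
import Data.Nat.Properties as ℕP
open import Data.Integer using (ℤ; +_; -[1+_]; _+_; _-_; _*_; -_; ∣_∣; _⊖_)
import Data.Integer as ℤ
import Data.Integer.Properties as ℤP
open import Data.Integer.Divisibility using (_∣_)
open import Data.Integer.GCD using (gcd)
open import Data.Integer.Tactic.RingSolver using (solve-∀)
open import Data.Parity.Base as ℙ using (Parity; 0ℙ; 1ℙ; _⁻¹)
import Data.Parity.Properties as ℙP
open import Data.Product using (_×_; _,_)
open import Data.Sum using (_⊎_; inj₂)
open import Data.Empty using (⊥; ⊥-elim)
open import Relation.Binary.PropositionalEquality
  using (_≡_; refl; sym; trans; cong; cong₂; module ≡-Reasoning)
open import Relation.Nullary using (¬_)

even⇒2∣ : ∀ n → parity n ≡ 0ℙ → 2 ℕd.∣ n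
even⇒2∣ zero          _ = ℕd.divides 0 refl
even⇒2∣ (suc (suc n)) e with even⇒2∣ n e
... | ℕd.divides q n≡q*2 = ℕd.divides (suc q) (cong (2 ℕ.+_) n≡q*2)

¬2∣⇒odd : ∀ n → ¬ (2 ℕd.∣ n) → parity n ≡ 1ℙ
¬2∣⇒odd n 2∤n with parity n in eq
... | 0ℙ = ⊥-elim (2∤n (even⇒2∣ n eq))
... | 1ℙ = refl

odd⇒%2≡1 : ∀ n → parity n ≡ 1ℙ → n ℕ.% 2 ≡ 1
odd⇒%2≡1 1             _ = refl
odd⇒%2≡1 (suc (suc n)) o = odd⇒%2≡1 n o

odd⇒val2≡0 : ∀ n → parity n ≡ 1ℙ → val2 n ≡ 0
odd⇒val2≡0 (suc n) o rewrite odd⇒%2≡1 (suc n) o = refl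

odd⇒oddPartℕ≡id : ∀ n → parity n ≡ 1ℙ → oddPartℕ n ≡ n
odd⇒oddPartℕ≡id (suc n) o rewrite odd⇒%2≡1 (suc n) o = refl

prime-odd : ∀ {p m} → Prime p → ¬ (p ℕd.∣ m) → 2 ℕd.∣ m → parity p ≡ 1ℙ
prime-odd {p} pp p∤m 2∣m = ¬2∣⇒odd p λ 2∣p → case (prime⇒irreducible pp 2∣p)
  where
  case : 2 ≡ 1 ⊎ 2 ≡ p → ⊥
  case (inj₂ refl) = p∤m 2∣m

parityℤ : ℤ → Parity
parityℤ x = parity ∣ x ∣

parityℤ-⊖ : ∀ m n → parityℤ (m ⊖ n) ≡ parity m ℙ.+ parity n
parityℤ-⊖ zero    zero    = refl
parityℤ-⊖ zero    (suc n) = refl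
parityℤ-⊖ (suc m) zero    = sym (ℙP.+-identityʳ (parity (suc m)))
parityℤ-⊖ (suc m) (suc n) = begin
  parityℤ (suc m ⊖ suc n)                      ≡⟨ cong parityℤ (ℤP.[1+m]⊖[1+n]≡m⊖n m n) ⟩
  parityℤ (m ⊖ n)                              ≡⟨ parityℤ-⊖ m n ⟩
  parity m ℙ.+ parity n                        ≡⟨ cong₂ ℙ._+_ (ℙP.suc-homo-⁻¹ m) (ℙP.suc-homo-⁻¹ n) ⟨
  parity (suc m) ⁻¹ ℙ.+ parity (suc n) ⁻¹     ≡⟨ ⁻¹+⁻¹ (parity (suc m)) (parity (suc n)) ⟩
  parity (suc m) ℙ.+ parity (suc n)            ∎
  where
  open ≡-Reasoning
  ⁻¹+⁻¹ : ∀ a b → a ⁻¹ ℙ.+ b ⁻¹ ≡ a ℙ.+ b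
  ⁻¹+⁻¹ 0ℙ 0ℙ = refl
  ⁻¹+⁻¹ 0ℙ 1ℙ = refl
  ⁻¹+⁻¹ 1ℙ _  = refl

parityℤ-+ : ∀ x y → parityℤ (x + y) ≡ parityℤ x ℙ.+ parityℤ y
parityℤ-+ (+ m)    (+ n)    = ℙP.+-homo-+ m n
parityℤ-+ (+ m)    -[1+ n ] = parityℤ-⊖ m (suc n)
parityℤ-+ -[1+ m ] (+ n)    = trans (parityℤ-⊖ n (suc m)) (ℙP.+-comm (parity n) (parity (suc m)))
parityℤ-+ -[1+ m ] -[1+ n ] =
  trans (cong parity (sym (ℕP.+-suc (suc m) n))) (ℙP.+-homo-+ (suc m) (suc n))

parityℤ-* : ∀ x y → parityℤ (x * y) ≡ parityℤ x ℙ.* parityℤ y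
parityℤ-* x y = trans (cong parity (ℤP.abs-* x y)) (ℙP.*-homo-* ∣ x ∣ ∣ y ∣)

parityℤ-- : ∀ x y → parityℤ (x - y) ≡ parityℤ x ℙ.+ parityℤ y
parityℤ-- x y = trans (parityℤ-+ x (- y)) (cong (parityℤ x ℙ.+_) (cong parity (ℤP.∣-i∣≡∣i∣ y)))

parityℤ-*-odd : ∀ x y → parityℤ y ≡ 1ℙ → parityℤ (x * y) ≡ parityℤ x
parityℤ-*-odd x y o = trans (parityℤ-* x y) (trans (cong (parityℤ x ℙ.*_) o) (ℙP.*-identityʳ (parityℤ x)))

odd⇒oddPart≡id : ∀ x → parityℤ x ≡ 1ℙ → oddPart x ≡ x
odd⇒oddPart≡id (+ n)    o = cong +_ (odd⇒oddPartℕ≡id n o)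
odd⇒oddPart≡id -[1+ n ] o = cong (λ m → - (+ m)) (odd⇒oddPartℕ≡id (suc n) o)

odd⇒oddPart-odd : ∀ x → parityℤ x ≡ 1ℙ → parityℤ (oddPart x) ≡ 1ℙ
odd⇒oddPart-odd x o = trans (cong parityℤ (odd⇒oddPart≡id x o)) o

-- Reduction mod 2 is proved once, for all integer polynomial expressions.
infixl 6 _⊕_ _⊝_
infixl 7 _⊗_

data Expr : Set where
  lit           : ℤ → Expr
  _⊕_ _⊗_ _⊝_ : Expr → Expr → Expr

⟦_⟧ : Expr → ℤ
⟦ lit x ⟧ = x
⟦ a ⊕ b ⟧ = ⟦ a ⟧ + ⟦ b ⟧
⟦ a ⊗ b ⟧ = ⟦ a ⟧ * ⟦ b ⟧
⟦ a ⊝ b ⟧ = ⟦ a ⟧ - ⟦ b ⟧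

⟦_⟧₂ : Expr → Parity
⟦ lit x ⟧₂ = parityℤ x
⟦ a ⊕ b ⟧₂ = ⟦ a ⟧₂ ℙ.+ ⟦ b ⟧₂
⟦ a ⊗ b ⟧₂ = ⟦ a ⟧₂ ℙ.* ⟦ b ⟧₂
⟦ a ⊝ b ⟧₂ = ⟦ a ⟧₂ ℙ.+ ⟦ b ⟧₂

parityℤ-⟦⟧ : ∀ e → parityℤ ⟦ e ⟧ ≡ ⟦ e ⟧₂
parityℤ-⟦⟧ (lit x) = refl
parityℤ-⟦⟧ (a ⊕ b) = trans (parityℤ-+ ⟦ a ⟧ ⟦ b ⟧) (cong₂ ℙ._+_ (parityℤ-⟦⟧ a) (parityℤ-⟦⟧ b))
parityℤ-⟦⟧ (a ⊗ b) = trans (parityℤ-* ⟦ a ⟧ ⟦ b ⟧) (cong₂ ℙ._*_ (parityℤ-⟦⟧ a) (parityℤ-⟦⟧ b))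
parityℤ-⟦⟧ (a ⊝ b) = trans (parityℤ-- ⟦ a ⟧ ⟦ b ⟧) (cong₂ ℙ._+_ (parityℤ-⟦⟧ a) (parityℤ-⟦⟧ b))

-- The 0ℙ is the coefficient 4 reduced mod 2.
discℙ : Parity → Parity → Parity → Parity
discℙ B A C = (B ℙ.* B) ℙ.+ (0ℙ ℙ.* A ℙ.* C)

formℙ : Parity → Parity → Parity → Parity → Parity → Parity
formℙ u v B A C = (u ℙ.* u) ℙ.+ (u ℙ.* v ℙ.* B) ℙ.+ (v ℙ.* v ℙ.* A ℙ.* C)

ρℙ : (v u B c A up v₁ A₁ : Parity) → Parity
ρℙ v u B c A up v₁ A₁ =
  let u' = u ℙ.+ (v ℙ.* B)
  in v ℙ.* ((u' ℙ.* c) ℙ.+ (A ℙ.* ((up ℙ.* (1ℙ ℙ.+ (u' ℙ.* u'))) ℙ.+ u')))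
     ℙ.+ (v₁ ℙ.* A₁ ℙ.* (u' ℙ.+ 1ℙ))

parityℤ-disc : ∀ B A C → parityℤ (B * B - + 4 * A * C) ≡ discℙ (parityℤ B) (parityℤ A) (parityℤ C)
parityℤ-disc B A C = parityℤ-⟦⟧ (lit B ⊗ lit B ⊝ lit (+ 4) ⊗ lit A ⊗ lit C)

parityℤ-form : ∀ u v B A C →
  parityℤ (u * u - u * v * B + v * v * A * C) ≡ formℙ (parityℤ u) (parityℤ v) (parityℤ B) (parityℤ A) (parityℤ C)
parityℤ-form u v B A C = parityℤ-⟦⟧ (lit u ⊗ lit u ⊝ lit u ⊗ lit v ⊗ lit B ⊕ lit v ⊗ lit v ⊗ lit A ⊗ lit C)

parityℤ-ρ : ∀ N A B v u cNp up → parityℤ (ρ N A B v u cNp up) ≡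
  ρℙ (parityℤ v) (parityℤ u) (parityℤ B) (parityℤ cNp) (parityℤ A) (parityℤ up)
     (parityℤ (oddPart v)) (parityℤ (oddPart A))
parityℤ-ρ N A B v u cNp up = parityℤ-⟦⟧
  (lit v ⊗ (u' ⊗ lit cNp ⊕ lit A ⊗ (lit up ⊗ (lit (+ 1) ⊝ u' ⊗ u') ⊝ u'))
   ⊕ lit (+ 3) ⊗ lit (oddPart v) ⊗ lit (oddPart A) ⊗ (u' ⊝ lit (+ 1)))
  where u' = lit u ⊝ lit v ⊗ lit B

ρℙ≡0-B-odd : ∀ u v A C v₁ A₁ → formℙ u v 1ℙ A C ≡ 1ℙ →
  (v ≡ 1ℙ → v₁ ≡ 1ℙ) → (A ≡ 1ℙ → A₁ ≡ 1ℙ) → ρℙ v u 1ℙ C A u v₁ A₁ ≡ 0ℙ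
ρℙ≡0-B-odd 0ℙ 0ℙ _  _  _  _  ()
ρℙ≡0-B-odd 1ℙ 0ℙ _  _  v₁ A₁ _ _ _ = ℙP.*-zeroʳ (v₁ ℙ.* A₁)
ρℙ≡0-B-odd 0ℙ 1ℙ 0ℙ _  _  _  ()
ρℙ≡0-B-odd 1ℙ 1ℙ 0ℙ _  _  _  ()
ρℙ≡0-B-odd 0ℙ 1ℙ 1ℙ 0ℙ _  _  ()
ρℙ≡0-B-odd 1ℙ 1ℙ 1ℙ 0ℙ _  _  ()
ρℙ≡0-B-odd 0ℙ 1ℙ 1ℙ 1ℙ _  _  _ v₁-odd A₁-odd rewrite v₁-odd refl | A₁-odd refl = refl
ρℙ≡0-B-odd 1ℙ 1ℙ 1ℙ 1ℙ _  _  _ v₁-odd A₁-odd rewrite v₁-odd refl | A₁-odd refl = refl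

ρℙ≡0 : ∀ {u v B A C c up v₁ A₁} → discℙ B A C ≡ 1ℙ → formℙ u v B A C ≡ 1ℙ →
  up ≡ u → c ≡ C → (v ≡ 1ℙ → v₁ ≡ 1ℙ) → (A ≡ 1ℙ → A₁ ≡ 1ℙ) → ρℙ v u B c A up v₁ A₁ ≡ 0ℙ
ρℙ≡0 {B = 0ℙ} ()
ρℙ≡0 {u} {v} {1ℙ} {A} {C} _ form refl refl = ρℙ≡0-B-odd u v A C _ _ form

θ-odd-N : ∀ N → parity N ≡ 1ℙ → ∀ A B v u cNp up →
  θ N A B v u cNp up ≡ (+ N - + 1) * ρ N A B v u cNp up
θ-odd-N N N-odd A B v u cNp up = begin
  θ-at (val2 N) (oddPartℕ N) ≡⟨ cong₂ θ-at (odd⇒val2≡0 N N-odd) (odd⇒oddPartℕ≡id N N-odd) ⟩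
  θ-at 0 N                   ≡⟨ distrib (+ N) v X (oddPart v) (oddPart A) u' ⟩
  (+ N - + 1) * ρ N A B v u cNp up ∎
  where
  open ≡-Reasoning
  u' = u - v * B
  X  = u' * cNp + A * (up * (+ 1 - u' * u') - u')
  θ-at : ℕ → ℕ → ℤ
  θ-at l N₁ = (+ N - + 1) * v * X + + 3 * oddPart v * oddPart A * (+ N₁ - + 1) * (u' - + 1)
              + (+ 3 * + l * (u' * u' - + 1)) ℤ./ℕ 2
  -- With l = 0 the last summand of θ-at computes to + 0.
  distrib : ∀ n v X v₁ A₁ w → (n - + 1) * v * X + + 3 * v₁ * A₁ * (n - + 1) * (w - + 1) + + 0
                            ≡ (n - + 1) * (v * X + + 3 * v₁ * A₁ * (w - + 1))
  distrib = solve-∀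

mainTheorem6 :
    (N : ℕ) → 1 < N → ¬ (2 ℕd.∣ N) →
    (D Δ : ℤ) (c : ℕ) → 1 ℕ.≤ c → IsFundamentalDisc Δ → D ≡ + (c ℕ.* c) * Δ → D ℤ.< + 0 →
    (A B C : ℤ) → gcd (gcd A B) C ≡ + 1 → + 0 ℤ.< A → B * B - + 4 * A * C ≡ D →
    gcd A (+ N) ≡ + 1 → (+ N) ∣ C →
    (u v : ℤ) (p : ℕ) → Prime p → + p ≡ u * u - u * v * B + v * v * A * C →
    ¬ (p ℕd.∣ 6 ℕ.* c ℕ.* N) → SplitsIn D p →
    (+ p) ∣ C → (+ p) ∣ u →
    (cNp up : ℤ) → C ≡ cNp * (+ N * + p) → u ≡ up * + p →
    ¬ ((+ 2) ∣ D) →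
    ((+ 8) ∣ (θ N A B v u cNp up - (+ N - + 1) * ρ N A B v u cNp up))
      × ((+ 2) ∣ ρ N A B v u cNp up)
mainTheorem6 N _ 2∤N D _ c _ _ _ _ A B C _ _ D≡disc _ _ u v p p-prime p≡form p∤6cN _ _ _
             cNp up C≡cNp*Np u≡up*p 2∤D =
  ℕd.divides 0 (cong ∣_∣ θ-[N-1]ρ≡0) , even⇒2∣ ∣ ρ N A B v u cNp up ∣ ρ-even
  where
  N-odd : parity N ≡ 1ℙ
  N-odd = ¬2∣⇒odd N 2∤N
  p-odd : parity p ≡ 1ℙ
  p-odd = prime-odd p-prime p∤6cN
            (ℕd.∣-trans (ℕd.divides 3 refl) (ℕd.∣-trans (ℕd.m∣m*n c) (ℕd.m∣m*n N)))

  θ-[N-1]ρ≡0 : θ N A B v u cNp up - (+ N - + 1) * ρ N A B v u cNp up ≡ + 0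
  θ-[N-1]ρ≡0 = ℤP.i≡j⇒i-j≡0 (θ-odd-N N N-odd A B v u cNp up)

  B-odd : discℙ (parityℤ B) (parityℤ A) (parityℤ C) ≡ 1ℙ
  B-odd = trans (sym (parityℤ-disc B A C)) (trans (cong parityℤ D≡disc) (¬2∣⇒odd ∣ D ∣ 2∤D))
  form-odd : formℙ (parityℤ u) (parityℤ v) (parityℤ B) (parityℤ A) (parityℤ C) ≡ 1ℙ
  form-odd = trans (sym (parityℤ-form u v B A C)) (trans (cong parityℤ (sym p≡form)) p-odd)
  up≡u : parityℤ up ≡ parityℤ u
  up≡u = sym (trans (cong parityℤ u≡up*p) (parityℤ-*-odd up (+ p) p-odd))
  cNp≡C : parityℤ cNp ≡ parityℤ C
  cNp≡C = sym (trans (cong parityℤ C≡cNp*Np)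
                     (parityℤ-*-odd cNp (+ N * + p) (trans (parityℤ-* (+ N) (+ p)) (cong₂ ℙ._*_ N-odd p-odd))))
  ρ-even : parityℤ (ρ N A B v u cNp up) ≡ 0ℙ
  ρ-even = trans (parityℤ-ρ N A B v u cNp up)
                 (ρℙ≡0 B-odd form-odd up≡u cNp≡C (odd⇒oddPart-odd v) (odd⇒oddPart-odd A))
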